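{- Let $n$ be an even positive integer and $\Delta_n^1=\{\beta\in B_n:\beta_n>0,\ \operatorname{fmaj}(\beta)\text{ odd}\}$. Then \[\sum_{\beta \in \Delta_n^1} (-1)^{\ell_B(\beta)}q^{\operatorname{fmaj}(\beta)}=0.\]
   Context: $B_n$ is the group of bijections $\beta$ of $[-n,n]\setminus\{0\}$ with $\beta(-i)=-\beta(i)$, written in window notation $\beta=[\beta_1,\dots,\beta_n]$ with $\beta_i=\beta(i)$. For $\beta\in B_n$: $\operatorname{inv}(\beta)=|\{(i,j): 1\le i<j\le n,\ \beta_i>\beta_j\}|$ (usual order on integers); $\operatorname{N}_1(\beta)=|\{i:\beta_i<0\}|$; $\operatorname{N}_2(\beta)=|\{\{i,j\}: i\neq j,\ \beta_i+\beta_j<0\}|$; $\ell_B(\beta)=\operatorname{inv}(\beta)+\operatorname{N}_1(\beta)+\operatorname{N}_2(\beta)$. The descent set $\operatorname{Des}(\beta)$ is the set of $i\in[n-1]$ with $\beta_i\succ\beta_{i+1}$, where $\prec$ is the total order $-1\prec-2\prec\cdots\prec-n\prec 1\prec 2\prec\cdots\prec n$; $\operatorname{maj}(\beta)=\sum_{i\in\operatorname{Des}(\beta)}i$ and $\operatorname{fmaj}(\beta)=2\operatorname{maj}(\beta)+\operatorname{N}_1(\beta)$. (For $\beta\in\{\beta\in B_n:\beta_n>0\}$ the paper writes $\operatorname{Dmaj}(\beta)=\operatorname{fmaj}(\beta)$.) -}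

module Defs where

open import Data.Nat as ℕ using (ℕ; zero; suc; _<ᵇ_; _%_; _≡ᵇ_)
open import Data.Integer as ℤ using (ℤ; +_; -[1+_]; ∣_∣; _<_; _<?_)
open import Data.List using (List; []; _∷_; length; map; filter; foldr; concatMap; _++_; upTo; applyUpTo; reverse)
open import Data.List.Relation.Unary.Unique.Propositional using (Unique)
open import Data.List.Relation.Unary.Unique.DecPropositional ℕ._≟_ using (unique?)
open import Data.List.Relation.Unary.All using (All)
open import Data.Bool using (Bool; true; false; if_then_else_)
open import Relation.Nullary.Decidable using (⌊_⌋)

-- An element β of B_n is represented by its window [β_1, …, β_n] (a list of integers).

values : ℕ → List ℤ
values n = map (λ i → -[1+ i ]) (upTo n) ++ map (λ i → + suc i) (upTo n)

words : ℕ → ℕ → List (List ℤ)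
words n zero    = [] ∷ []
words n (suc k) = concatMap (λ x → map (x ∷_) (words n k)) (values n)

-- A window of length n with entries in [-n,n]\{0} is a signed permutation
-- iff its absolute values are pairwise distinct.
isSignedPerm : List ℤ → Bool
isSignedPerm w = ⌊ unique? (map ∣_∣ w) ⌋

Bn : ℕ → List (List ℤ)
Bn n = filter (λ w → Data.Bool._≟_ (isSignedPerm w) true) (words n n)

count : {A : Set} → (A → Bool) → List A → ℕ
count p []       = 0
count p (x ∷ xs) = (if p x then 1 else 0) ℕ.+ count p xs

ltᵇ : ℤ → ℤ → Bool
ltᵇ a b = ⌊ a <? b ⌋

inv : List ℤ → ℕ
inv []       = 0
inv (x ∷ xs) = count (λ y → ltᵇ y x) xs ℕ.+ inv xs

N1 : List ℤ → ℕ
N1 w = count (λ x → ltᵇ x (+ 0)) w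

N2 : List ℤ → ℕ
N2 []       = 0
N2 (x ∷ xs) = count (λ y → ltᵇ (x ℤ.+ y) (+ 0)) xs ℕ.+ N2 xs

ℓB : List ℤ → ℕ
ℓB w = inv w ℕ.+ N1 w ℕ.+ N2 w

-- The total order -1 ≺ -2 ≺ ⋯ ≺ -n ≺ 1 ≺ ⋯ ≺ n, via a rank function
-- (rank of -i is i, rank of i is n + i).
rank : ℕ → ℤ → ℕ
rank n (+ i)      = n ℕ.+ i
rank n -[1+ i ]   = suc i

succᵇ : ℕ → ℤ → ℤ → Bool
succᵇ n a b = rank n b <ᵇ rank n a

-- maj: sum of descent positions i (1-indexed), i.e. i ∈ [n-1] with β_i ≻ β_{i+1}.
-- majFrom n i w : contribution when the head of w is at position i.
majFrom : ℕ → ℕ → List ℤ → ℕ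
majFrom n i []           = 0
majFrom n i (x ∷ [])     = 0
majFrom n i (x ∷ y ∷ ys) = (if succᵇ n x y then i else 0) ℕ.+ majFrom n (suc i) (y ∷ ys)

maj : ℕ → List ℤ → ℕ
maj n w = majFrom n 1 w

fmaj : ℕ → List ℤ → ℕ
fmaj n w = 2 ℕ.* maj n w ℕ.+ N1 w

lastPos : List ℤ → Bool
lastPos []           = false
lastPos (x ∷ [])     = ltᵇ (+ 0) x
lastPos (x ∷ y ∷ ys) = lastPos (y ∷ ys)

oddᵇ : ℕ → Bool
oddᵇ m = (m % 2) ≡ᵇ 1

Delta1 : ℕ → List (List ℤ)
Delta1 n = filter (λ w → Data.Bool._≟_ (lastPos w Data.Bool.∧ oddᵇ (fmaj n w)) true) (Bn n)

signℤ : ℕ → ℤ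
signℤ m = if (m % 2) ≡ᵇ 0 then + 1 else ℤ.- (+ 1)

sumℤ : List ℤ → ℤ
sumℤ = foldr ℤ._+_ (+ 0)

-- coefficient of q^k in  Σ_{β ∈ Δ_n^1} (-1)^{ℓ_B(β)} q^{fmaj(β)}
coeffDelta1 : ℕ → ℕ → ℤ
coeffDelta1 n k = sumℤ (map (λ w → if fmaj n w ≡ᵇ k then signℤ (ℓB w) else + 0) (Delta1 n))

open import Relation.Binary.PropositionalEquality using (_≡_; refl)
_ : length (Bn 2) ≡ 8
_ = refl

-- For a window w and m = 2j, call {m + 1, m + 2} an opposite pair of w if these absolute values
-- occur in w with opposite signs, and toggle w by exchanging the absolute values m + 1 and m + 2
-- (keeping signs) for the least such j.  The values −(m + 1), −(m + 2) and m + 1, m + 2 are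
-- ≺-adjacent and the exchanged entries have opposite signs, so no ≺-comparison between entries
-- changes: Des, maj, N1, fmaj and the sign of β_n are preserved.  Among all pairs of positions only
-- the pair carrying −(m + 1) and m + 2 changes its contribution to inv + N2, by exactly one, so
-- (−1)^ℓ_B changes sign.  The least opposite pair is unchanged by the exchange, so toggling is an
-- involution.  If w has no opposite pair then, as n is even, the negative entries come in pairs
-- −(2j + 1), −(2j + 2); so N1 and hence fmaj = 2 maj + N1 are even, and w ∉ Δ_n^1.  Thus the terms
-- of the sum cancel in pairs.
module Submission where

open import Defs
open import Data.Nat using (ℕ; _<_; _%_)
open import Data.Integer using (+_)
open import Relation.Binary.PropositionalEquality using (_≡_)

open import Data.Bool using (Bool; true; false; if_then_else_; _∧_; _∨_; not)
open import Data.Bool.Properties using (∧-zeroʳ; ∧-identityʳ; ∧-comm; ∨-comm; ∨-zeroʳ)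
open import Data.Empty using (⊥; ⊥-elim)
open import Data.Integer as ℤ using (ℤ; -[1+_]; ∣_∣; -_)
import Data.Integer.Properties as ℤ
open import Data.List using (List; []; _∷_; map; length; upTo; _++_; concatMap; filter)
open import Data.List.Properties using (map-∘; map-cong; map-cong-local; length-map; length-upTo; ∷-injectiveʳ; length-++-sucʳ)
open import Data.List.Membership.Propositional using (_∈_; _∉_; find)
open import Data.List.Membership.DecPropositional ℤ._≟_ using (_∈?_)
open import Data.List.Membership.Propositional.Properties
open import Data.List.Membership.Propositional.Properties.WithK using (unique∧set⇒bag)
open import Data.List.Relation.Binary.BagAndSetEquality using (∼bag⇒↭)
open import Data.List.Relation.Binary.Permutation.Propositional using (_↭_; ↭⇒↭ₛ)
import Data.List.Relation.Binary.Permutation.Propositional.Properties as ↭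
open import Data.List.Relation.Binary.Permutation.Setoid.Properties using (foldr-commMonoid)
open import Data.List.Relation.Unary.All as All using (All; []; _∷_)
import Data.List.Relation.Unary.All.Properties as All
open import Data.List.Relation.Unary.Any as Any using (Any; here; there)
open import Data.List.Relation.Unary.Unique.Propositional using (Unique)
open import Data.List.Relation.Unary.AllPairs using ([]; _∷_)
import Data.List.Relation.Unary.Unique.Propositional.Properties as Unique
open import Data.Maybe using (Maybe; just; nothing)
open import Data.Nat as ℕ using (zero; suc; _+_; _*_; _/_; _≤_; _<ᵇ_; _≡ᵇ_; z≤n; s≤s)
import Data.Nat.Properties as ℕ
open import Data.Nat.ListAction using (sum)
open import Data.Nat.DivMod using (m≡m%n+[m/n]*n; m*n%n≡0; [m+n]%n≡m%n)
open import Data.Integer.Tactic.RingSolver using (solve-∀)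
open import Data.List.Membership.DecPropositional ℕ._≟_ using () renaming (_∈?_ to _∈ℕ?_)
open import Algebra.Properties.CommutativeSemigroup ℕ.+-commutativeSemigroup using (interchange; xy∙z≈xz∙y)
open import Data.Product using (_×_; _,_; proj₁; proj₂; ∃)
open import Data.Sum using (_⊎_; inj₁; inj₂)
open import Function using (_∘_)
open import Function.Bundles using (mk⇔)
open import Relation.Nullary using (¬_; Dec; yes; no; does)
open import Relation.Nullary.Decidable using (⌊_⌋; isYes≗does; does-⇔)
open import Relation.Binary.PropositionalEquality

sumℤ-↭ : ∀ {xs ys} → xs ↭ ys → sumℤ xs ≡ sumℤ ys
sumℤ-↭ p = foldr-commMonoid (setoid ℤ) ℤ.+-0-isCommutativeMonoid (↭⇒↭ₛ p)

sumℤ-map-neg : ∀ {A : Set} (g : A → ℤ) xs → sumℤ (map (-_ ∘ g) xs) ≡ - sumℤ (map g xs)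
sumℤ-map-neg g []       = refl
sumℤ-map-neg g (x ∷ xs) = trans (cong (ℤ._+_ (- g x)) (sumℤ-map-neg g xs)) (sym (ℤ.neg-distrib-+ (g x) _))

≡-neg⇒≡0 : ∀ {s : ℤ} → s ≡ - s → s ≡ + 0
≡-neg⇒≡0 {+ zero}  _  = refl
≡-neg⇒≡0 {+ suc _} ()
≡-neg⇒≡0 { -[1+ _ ]} ()

module _ {A : Set} {f : A → A} (f-involutive : ∀ x → f (f x) ≡ x) where

  involution⇒↭ : ∀ {xs} → Unique xs → (∀ {x} → x ∈ xs → f x ∈ xs) → map f xs ↭ xs
  involution⇒↭ {xs} unique closed =
    ∼bag⇒↭ (unique∧set⇒bag (Unique.map⁺ f-injective unique) unique (mk⇔ to from))
    where
    f-injective : ∀ {x y} → f x ≡ f y → x ≡ y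
    f-injective {x} {y} e = trans (sym (f-involutive x)) (trans (cong f e) (f-involutive y))
    to : ∀ {x} → x ∈ map f xs → x ∈ xs
    to p with ∈-map⁻ f p
    ... | _ , q , refl = closed q
    from : ∀ {x} → x ∈ xs → x ∈ map f xs
    from {x} p = subst (_∈ map f xs) (f-involutive x) (∈-map⁺ f (closed p))

  sumℤ-signReversing≡0 : ∀ {xs} → Unique xs → (∀ {x} → x ∈ xs → f x ∈ xs) →
                          (g : A → ℤ) → (∀ {x} → x ∈ xs → g (f x) ≡ - g x) → sumℤ (map g xs) ≡ + 0
  sumℤ-signReversing≡0 {xs} unique closed g reverses = ≡-neg⇒≡0 (begin
    sumℤ (map g xs)          ≡⟨ sumℤ-↭ (↭.map⁺ g (involution⇒↭ unique closed)) ⟨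
    sumℤ (map g (map f xs))  ≡⟨ cong sumℤ (map-∘ xs) ⟨
    sumℤ (map (g ∘ f) xs)    ≡⟨ cong sumℤ (map-cong-local (All.tabulate reverses)) ⟩
    sumℤ (map (-_ ∘ g) xs)   ≡⟨ sumℤ-map-neg g xs ⟩
    - sumℤ (map g xs)        ∎)
    where open ≡-Reasoning

module _ {A : Set} where

  ∈⇒length≡suc : ∀ {v : A} {ys} → v ∈ ys →
                 ∃ λ ys′ → length ys ≡ suc (length ys′) × (∀ {x} → x ∈ ys → x ≢ v → x ∈ ys′)
  ∈⇒length≡suc {v} p with ∈-∃++ p
  ... | us , vs , refl = us ++ vs , length-++-sucʳ us v vs , keep
    where
    keep : ∀ {x} → x ∈ us ++ v ∷ vs → x ≢ v → x ∈ us ++ vs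
    keep q x≢v with ∈-++⁻ us q
    ... | inj₁ q₁         = ∈-++⁺ˡ q₁
    ... | inj₂ (here x≡v) = ⊥-elim (x≢v x≡v)
    ... | inj₂ (there q₂) = ∈-++⁺ʳ us q₂

  Unique-⊆⇒length≤ : ∀ {xs ys : List A} → Unique xs → (∀ {x} → x ∈ xs → x ∈ ys) → length xs ≤ length ys
  Unique-⊆⇒length≤ {[]}     _        _  = z≤n
  Unique-⊆⇒length≤ {x ∷ xs} (u ∷ us) xs⊆ys with ∈⇒length≡suc (xs⊆ys (here refl))
  ... | ys′ , eq , keep = subst (suc (length xs) ≤_) (sym eq)
    (s≤s (Unique-⊆⇒length≤ us (λ q → keep (xs⊆ys (there q)) (λ e → All.lookup u q (sym e)))))

  Unique-⊂⇒length< : ∀ {xs ys : List A} {v} → Unique xs → (∀ {x} → x ∈ xs → x ∈ ys) →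
                      v ∈ ys → v ∉ xs → length xs < length ys
  Unique-⊂⇒length< {xs} unique xs⊆ys v∈ys v∉xs with ∈⇒length≡suc v∈ys
  ... | ys′ , eq , keep = subst (length xs <_) (sym eq)
    (s≤s (Unique-⊆⇒length≤ unique (λ q → keep (xs⊆ys q) (λ { refl → v∉xs q }))))

search : (ℕ → Bool) → ℕ → ℕ → Maybe ℕ
search p j zero    = nothing
search p j (suc f) = if p j then just j else search p (suc j) f

search-sound : ∀ p j f {r} → search p j f ≡ just r → p r ≡ true
search-sound p j (suc f) e with p j in pj
search-sound p j (suc f) refl | true = pj
... | false = search-sound p (suc j) f e

search-complete : ∀ p j f → search p j f ≡ nothing → ∀ {i} → j ≤ i → i < j + f → p i ≡ false
search-complete p j zero    _ j≤i i<j+0 = ⊥-elim (ℕ.<-irrefl refl (ℕ.≤-<-trans j≤i (subst (_ <_) (ℕ.+-identityʳ j) i<j+0)))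
search-complete p j (suc f) e {i} j≤i i<j+f with p j in pj
search-complete p j (suc f) () j≤i i<j+f | true
... | false with ℕ.m≤n⇒m<n∨m≡n j≤i
...   | inj₂ refl = pj
...   | inj₁ j<i  = search-complete p (suc j) f e j<i (subst (i <_) (ℕ.+-suc j f) i<j+f)

search-cong : ∀ {p q} → (∀ i → p i ≡ q i) → ∀ j f → search p j f ≡ search q j f
search-cong p≗q j zero    = refl
search-cong p≗q j (suc f) rewrite p≗q j | search-cong p≗q (suc j) f = refl

toℕ : Bool → ℕ
toℕ b = if b then 1 else 0

∧∨∧-comm : ∀ p q r s → (p ∧ q) ∨ (r ∧ s) ≡ (s ∧ r) ∨ (q ∧ p)
∧∨∧-comm p q r s = trans (∨-comm (p ∧ q) (r ∧ s)) (cong₂ _∨_ (∧-comm r s) (∧-comm p q))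

∧≡true : ∀ p q → (p ∧ q) ≡ true → p ≡ true × q ≡ true
∧≡true true true _ = refl , refl

∧∨∧≡true : ∀ p q r s → (p ∧ q) ∨ (r ∧ s) ≡ true → (p ≡ true × q ≡ true) ⊎ (r ≡ true × s ≡ true)
∧∨∧≡true true  true  r s _ = inj₁ (refl , refl)
∧∨∧≡true true  false r s e = inj₂ (∧≡true r s e)
∧∨∧≡true false q     r s e = inj₂ (∧≡true r s e)

≡ᵇ-refl : ∀ m → (m ≡ᵇ m) ≡ true
≡ᵇ-refl zero    = refl
≡ᵇ-refl (suc m) = ≡ᵇ-refl m

≢⇒≡ᵇ≡false : ∀ {i j} → i ≢ j → (i ≡ᵇ j) ≡ false
≢⇒≡ᵇ≡false {zero}  {zero}  i≢j = ⊥-elim (i≢j refl)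
≢⇒≡ᵇ≡false {zero}  {suc j} _   = refl
≢⇒≡ᵇ≡false {suc i} {zero}  _   = refl
≢⇒≡ᵇ≡false {suc i} {suc j} i≢j = ≢⇒≡ᵇ≡false (i≢j ∘ cong suc)

<⇒<ᵇ≡true : ∀ {a b} → a < b → (a <ᵇ b) ≡ true
<⇒<ᵇ≡true {zero}  {suc b} _         = refl
<⇒<ᵇ≡true {suc a} {suc b} (s≤s a<b) = <⇒<ᵇ≡true a<b

≤⇒<ᵇ≡false : ∀ {a b} → b ≤ a → (a <ᵇ b) ≡ false
≤⇒<ᵇ≡false {a}     {zero}  _         = refl
≤⇒<ᵇ≡false {suc a} {suc b} (s≤s b≤a) = ≤⇒<ᵇ≡false b≤a

+-<ᵇ-cancelˡ : ∀ n a b → (n + a <ᵇ n + b) ≡ (a <ᵇ b)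
+-<ᵇ-cancelˡ zero    a b = refl
+-<ᵇ-cancelˡ (suc n) a b = +-<ᵇ-cancelˡ n a b

isYes≡true⇒ : ∀ {P : Set} (d : Dec P) → ⌊ d ⌋ ≡ true → P
isYes≡true⇒ (yes p) _ = p

⇒isYes≡true : ∀ {P : Set} (d : Dec P) → P → ⌊ d ⌋ ≡ true
⇒isYes≡true (yes _) _ = refl
⇒isYes≡true (no ¬p) p = ⊥-elim (¬p p)

if-then-neg : ∀ b (s : ℤ) → (if b then - s else + 0) ≡ - (if b then s else + 0)
if-then-neg true  s = refl
if-then-neg false s = refl

ltᵇ-+-+ : ∀ a b → ltᵇ (+ a) (+ b) ≡ (a <ᵇ b)
ltᵇ-+-+ a b = isYes≗does _

ltᵇ-−-− : ∀ a b → ltᵇ -[1+ a ] -[1+ b ] ≡ (b <ᵇ a)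
ltᵇ-−-− a b = isYes≗does _

ltᵇ-⊖-0 : ∀ a b → ltᵇ (a ℤ.⊖ suc b) (+ 0) ≡ (a <ᵇ suc b)
ltᵇ-⊖-0 zero    b       = refl
ltᵇ-⊖-0 (suc a) zero    rewrite ℤ.[1+m]⊖[1+n]≡m⊖n a zero    = ltᵇ-+-+ a 0
ltᵇ-⊖-0 (suc a) (suc b) rewrite ℤ.[1+m]⊖[1+n]≡m⊖n a (suc b) = ltᵇ-⊖-0 a b

swap : ℕ → ℕ → ℕ
swap zero    zero          = 1
swap zero    (suc zero)    = 0
swap zero    (suc (suc i)) = suc (suc i)
swap (suc m) zero          = zero
swap (suc m) (suc i)       = suc (swap m i)

swap-involutive : ∀ m i → swap m (swap m i) ≡ i
swap-involutive zero    zero          = refl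
swap-involutive zero    (suc zero)    = refl
swap-involutive zero    (suc (suc i)) = refl
swap-involutive (suc m) zero          = refl
swap-involutive (suc m) (suc i)       = cong suc (swap-involutive m i)

swap-left : ∀ m → swap m m ≡ suc m
swap-left zero    = refl
swap-left (suc m) = cong suc (swap-left m)

swap-right : ∀ m → swap m (suc m) ≡ m
swap-right zero    = refl
swap-right (suc m) = cong suc (swap-right m)

swap-fixes : ∀ m {i} → i ≢ m → i ≢ suc m → swap m i ≡ i
swap-fixes zero    {zero}          i≢m _    = ⊥-elim (i≢m refl)
swap-fixes zero    {suc zero}      _   i≢m′ = ⊥-elim (i≢m′ refl)
swap-fixes zero    {suc (suc i)}   _   _    = refl
swap-fixes (suc m) {zero}          _   _    = refl
swap-fixes (suc m) {suc i}         i≢m i≢m′ = cong suc (swap-fixes m (i≢m ∘ cong suc) (i≢m′ ∘ cong suc))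

swap-fixed-or-≤ : ∀ m i → swap m i ≡ i ⊎ swap m i ≤ suc m
swap-fixed-or-≤ zero    zero          = inj₂ (s≤s z≤n)
swap-fixed-or-≤ zero    (suc zero)    = inj₂ z≤n
swap-fixed-or-≤ zero    (suc (suc i)) = inj₁ refl
swap-fixed-or-≤ (suc m) zero          = inj₁ refl
swap-fixed-or-≤ (suc m) (suc i) with swap-fixed-or-≤ m i
... | inj₁ e = inj₁ (cong suc e)
... | inj₂ l = inj₂ (s≤s l)

swap-< : ∀ {n} m {i} → i < n → suc m < n → swap m i < n
swap-< m {i} i<n m′<n with swap-fixed-or-≤ m i
... | inj₁ e = subst (_< _) (sym e) i<n
... | inj₂ l = ℕ.≤-<-trans l m′<n

suc-¬× : ∀ {a b c d} → ¬ (suc a ≡ suc b × suc c ≡ suc d) → ¬ (a ≡ b × c ≡ d)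
suc-¬× ¬e (a≡b , c≡d) = ¬e (cong suc a≡b , cong suc c≡d)

swap-<ᵇ : ∀ m i k → ¬ (i ≡ m × k ≡ suc m) → ¬ (i ≡ suc m × k ≡ m) →
          (swap m i <ᵇ swap m k) ≡ (i <ᵇ k)
swap-<ᵇ zero    zero          zero          _  _  = refl
swap-<ᵇ zero    zero          (suc zero)    ¬e _  = ⊥-elim (¬e (refl , refl))
swap-<ᵇ zero    zero          (suc (suc k)) _  _  = refl
swap-<ᵇ zero    (suc zero)    zero          _  ¬e = ⊥-elim (¬e (refl , refl))
swap-<ᵇ zero    (suc zero)    (suc zero)    _  _  = refl
swap-<ᵇ zero    (suc zero)    (suc (suc k)) _  _  = refl
swap-<ᵇ zero    (suc (suc i)) zero          _  _  = refl
swap-<ᵇ zero    (suc (suc i)) (suc zero)    _  _  = refl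
swap-<ᵇ zero    (suc (suc i)) (suc (suc k)) _  _  = refl
swap-<ᵇ (suc m) zero          zero          _  _  = refl
swap-<ᵇ (suc m) zero          (suc k)       _  _  = refl
swap-<ᵇ (suc m) (suc i)       zero          _  _  = refl
swap-<ᵇ (suc m) (suc i)       (suc k)       ¬e ¬e′ = swap-<ᵇ m i k (suc-¬× ¬e) (suc-¬× ¬e′)

swap-<ᵇ-gain : ∀ m i k → ¬ (i ≡ m × k ≡ suc m) →
               toℕ (swap m i <ᵇ swap m k) ≡ toℕ (i <ᵇ k) + toℕ ((i ≡ᵇ suc m) ∧ (k ≡ᵇ m))
swap-<ᵇ-gain zero    zero          zero          _  = refl
swap-<ᵇ-gain zero    zero          (suc zero)    ¬e = ⊥-elim (¬e (refl , refl))
swap-<ᵇ-gain zero    zero          (suc (suc k)) _  = refl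
swap-<ᵇ-gain zero    (suc zero)    zero          _  = refl
swap-<ᵇ-gain zero    (suc zero)    (suc zero)    _  = refl
swap-<ᵇ-gain zero    (suc zero)    (suc (suc k)) _  = refl
swap-<ᵇ-gain zero    (suc (suc i)) zero          _  = refl
swap-<ᵇ-gain zero    (suc (suc i)) (suc zero)    _  = refl
swap-<ᵇ-gain zero    (suc (suc i)) (suc (suc k)) _  = sym (ℕ.+-identityʳ _)
swap-<ᵇ-gain (suc m) zero          zero          _  = refl
swap-<ᵇ-gain (suc m) zero          (suc k)       _  = refl
swap-<ᵇ-gain (suc m) (suc i)       zero          _  rewrite ∧-zeroʳ (i ≡ᵇ suc m) = refl
swap-<ᵇ-gain (suc m) (suc i)       (suc k)       ¬e = swap-<ᵇ-gain m i k (suc-¬× ¬e)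

-- -[1+ i ] and + suc i have absolute value i + 1: swapAbs m exchanges the absolute values m + 1 and m + 2.
swapAbs : ℕ → ℤ → ℤ
swapAbs m (+ zero)  = + zero
swapAbs m (+ suc i) = + suc (swap m i)
swapAbs m -[1+ i ]  = -[1+ swap m i ]

swapAbs-involutive : ∀ m x → swapAbs m (swapAbs m x) ≡ x
swapAbs-involutive m (+ zero)  = refl
swapAbs-involutive m (+ suc i) = cong (+_ ∘ suc) (swap-involutive m i)
swapAbs-involutive m -[1+ i ]  = cong -[1+_] (swap-involutive m i)

map-swapAbs-involutive : ∀ m w → map (swapAbs m) (map (swapAbs m) w) ≡ w
map-swapAbs-involutive m []      = refl
map-swapAbs-involutive m (x ∷ w) = cong₂ _∷_ (swapAbs-involutive m x) (map-swapAbs-involutive m w)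

∣swapAbs∣ : ∀ m x → ∣ swapAbs m x ∣ ≡ swap (suc m) ∣ x ∣
∣swapAbs∣ m (+ zero)  = refl
∣swapAbs∣ m (+ suc i) = refl
∣swapAbs∣ m -[1+ i ]  = refl

swapAbs-isNeg : ∀ m x → ltᵇ (swapAbs m x) (+ 0) ≡ ltᵇ x (+ 0)
swapAbs-isNeg m (+ zero)  = refl
swapAbs-isNeg m (+ suc i) = trans (ltᵇ-+-+ (suc (swap m i)) 0) (sym (ltᵇ-+-+ (suc i) 0))
swapAbs-isNeg m -[1+ i ]  = refl

swapAbs-isPos : ∀ m x → ltᵇ (+ 0) (swapAbs m x) ≡ ltᵇ (+ 0) x
swapAbs-isPos m (+ zero)  = refl
swapAbs-isPos m (+ suc i) = trans (ltᵇ-+-+ 0 (suc (swap m i))) (sym (ltᵇ-+-+ 0 (suc i)))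
swapAbs-isPos m -[1+ i ]  = refl

InRange : ℕ → ℤ → Set
InRange n (+ zero)  = ⊥
InRange n (+ suc i) = i < n
InRange n -[1+ i ]  = i < n

swapAbs-InRange : ∀ {n} m {x} → suc m < n → InRange n x → InRange n (swapAbs m x)
swapAbs-InRange m {+ suc i} m′<n i<n = swap-< m i<n m′<n
swapAbs-InRange m { -[1+ i ]} m′<n i<n = swap-< m i<n m′<n

-- x ∉ {0, m + 1, −(m + 2)}
Compatible : ℕ → ℤ → Set
Compatible m (+ zero)  = ⊥
Compatible m (+ suc i) = i ≢ m
Compatible m -[1+ i ]  = i ≢ suc m

pairLength : ℤ → ℤ → ℕ
pairLength x y = toℕ (ltᵇ y x) + toℕ (ltᵇ (x ℤ.+ y) (+ 0))

-- 1 exactly when {x, y} = {−(m + 1), m + 2}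
swapPair : ℕ → ℤ → ℤ → ℕ
swapPair m (+ suc i) -[1+ k ] = toℕ ((i ≡ᵇ suc m) ∧ (k ≡ᵇ m))
swapPair m -[1+ i ] (+ suc k) = toℕ ((k ≡ᵇ suc m) ∧ (i ≡ᵇ m))
swapPair m _         _        = 0

pairLength-swapAbs : ∀ m x y → Compatible m x → Compatible m y →
                     pairLength (swapAbs m x) (swapAbs m y) ≡ pairLength x y + swapPair m x y
pairLength-swapAbs m (+ suc i) (+ suc k) i≢m k≢m = begin
  toℕ (ltᵇ (+ suc (swap m k)) (+ suc (swap m i))) + 0 ≡⟨ cong (λ b → toℕ b + 0) (ltᵇ-+-+ _ _) ⟩
  toℕ (swap m k <ᵇ swap m i) + 0                     ≡⟨ cong (λ b → toℕ b + 0) (swap-<ᵇ m k i (k≢m ∘ proj₁) (i≢m ∘ proj₂)) ⟩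
  toℕ (k <ᵇ i) + 0                                   ≡⟨ cong (λ b → toℕ b + 0) (ltᵇ-+-+ _ _) ⟨
  toℕ (ltᵇ (+ suc k) (+ suc i)) + 0                  ≡⟨ ℕ.+-identityʳ _ ⟨
  pairLength (+ suc i) (+ suc k) + 0                 ∎
  where open ≡-Reasoning
pairLength-swapAbs m (+ suc i) -[1+ k ] i≢m _ = cong suc (begin
  toℕ (ltᵇ (suc (swap m i) ℤ.⊖ suc (swap m k)) (+ 0)) ≡⟨ cong toℕ (ltᵇ-⊖-0 (suc (swap m i)) (swap m k)) ⟩
  toℕ (swap m i <ᵇ swap m k)                         ≡⟨ swap-<ᵇ-gain m i k (i≢m ∘ proj₁) ⟩
  toℕ (i <ᵇ k) + swapPair m (+ suc i) -[1+ k ]       ≡⟨ cong (λ b → toℕ b + swapPair m (+ suc i) -[1+ k ]) (ltᵇ-⊖-0 (suc i) k) ⟨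
  toℕ (ltᵇ (suc i ℤ.⊖ suc k) (+ 0)) + swapPair m (+ suc i) -[1+ k ] ∎)
  where open ≡-Reasoning
pairLength-swapAbs m -[1+ i ] (+ suc k) i≢m′ _ = begin
  toℕ (ltᵇ (suc (swap m k) ℤ.⊖ suc (swap m i)) (+ 0)) ≡⟨ cong toℕ (ltᵇ-⊖-0 (suc (swap m k)) (swap m i)) ⟩
  toℕ (swap m k <ᵇ swap m i)                         ≡⟨ swap-<ᵇ-gain m k i (i≢m′ ∘ proj₂) ⟩
  toℕ (k <ᵇ i) + swapPair m -[1+ i ] (+ suc k)       ≡⟨ cong (λ b → toℕ b + swapPair m -[1+ i ] (+ suc k)) (ltᵇ-⊖-0 (suc k) i) ⟨
  toℕ (ltᵇ (suc k ℤ.⊖ suc i) (+ 0)) + swapPair m -[1+ i ] (+ suc k) ∎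
  where open ≡-Reasoning
pairLength-swapAbs m -[1+ i ] -[1+ k ] i≢m′ k≢m′ = begin
  toℕ (ltᵇ -[1+ swap m k ] -[1+ swap m i ]) + 1 ≡⟨ cong (λ b → toℕ b + 1) (ltᵇ-−-− _ _) ⟩
  toℕ (swap m i <ᵇ swap m k) + 1                ≡⟨ cong (λ b → toℕ b + 1) (swap-<ᵇ m i k (k≢m′ ∘ proj₂) (i≢m′ ∘ proj₁)) ⟩
  toℕ (i <ᵇ k) + 1                              ≡⟨ cong (λ b → toℕ b + 1) (ltᵇ-−-− _ _) ⟨
  toℕ (ltᵇ -[1+ k ] -[1+ i ]) + 1               ≡⟨ ℕ.+-identityʳ _ ⟨
  pairLength -[1+ i ] -[1+ k ] + 0              ∎
  where open ≡-Reasoning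

rank-neg<rank-pos : ∀ {n i} k → i < n → (suc i <ᵇ n + suc k) ≡ true
rank-neg<rank-pos {n} {i} k i<n =
  <⇒<ᵇ≡true (subst (suc i <_) (sym (ℕ.+-suc n k)) (s≤s (ℕ.≤-trans i<n (ℕ.m≤m+n n k))))

succᵇ-swapAbs : ∀ {n} m x y → suc m < n → InRange n x → InRange n y → Compatible m x → Compatible m y →
                succᵇ n (swapAbs m x) (swapAbs m y) ≡ succᵇ n x y
succᵇ-swapAbs {n} m (+ suc i) (+ suc k) _ _ _ i≢m k≢m =
  trans (+-<ᵇ-cancelˡ n (suc (swap m k)) (suc (swap m i)))
  (trans (swap-<ᵇ m k i (k≢m ∘ proj₁) (i≢m ∘ proj₂)) (sym (+-<ᵇ-cancelˡ n (suc k) (suc i))))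
succᵇ-swapAbs m (+ suc i) -[1+ k ] m′<n _ k<n _ _ =
  trans (rank-neg<rank-pos (swap m i) (swap-< m k<n m′<n)) (sym (rank-neg<rank-pos i k<n))
succᵇ-swapAbs {n} m -[1+ i ] (+ suc k) m′<n i<n _ _ _ =
  trans (≤⇒<ᵇ≡false (ℕ.≤-trans (swap-< m i<n m′<n) (ℕ.m≤m+n n _)))
  (sym (≤⇒<ᵇ≡false (ℕ.≤-trans i<n (ℕ.m≤m+n n _))))
succᵇ-swapAbs m -[1+ i ] -[1+ k ] _ _ _ i≢m′ k≢m′ = swap-<ᵇ m k i (i≢m′ ∘ proj₂) (k≢m′ ∘ proj₁)

count-map : ∀ (p : ℤ → Bool) f → (∀ x → p (f x) ≡ p x) → ∀ w → count p (map f w) ≡ count p w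
count-map p f p∘f≗p []      = refl
count-map p f p∘f≗p (x ∷ w) rewrite p∘f≗p x = cong (_+_ (toℕ (p x))) (count-map p f p∘f≗p w)

N1-swapAbs : ∀ m w → N1 (map (swapAbs m) w) ≡ N1 w
N1-swapAbs m = count-map (λ x → ltᵇ x (+ 0)) (swapAbs m) (swapAbs-isNeg m)

lastPos-swapAbs : ∀ m w → lastPos (map (swapAbs m) w) ≡ lastPos w
lastPos-swapAbs m []           = refl
lastPos-swapAbs m (x ∷ [])     = swapAbs-isPos m x
lastPos-swapAbs m (x ∷ y ∷ ys) = lastPos-swapAbs m (y ∷ ys)

majFrom-map : ∀ {P : ℤ → Set} n f → (∀ {x y} → P x → P y → succᵇ n (f x) (f y) ≡ succᵇ n x y) →
              ∀ i {w} → All P w → majFrom n i (map f w) ≡ majFrom n i w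
majFrom-map n f f-pres i []                    = refl
majFrom-map n f f-pres i (_ ∷ [])              = refl
majFrom-map n f f-pres i (px ∷ py ∷ pys) =
  cong₂ _+_ (cong (λ b → if b then i else 0) (f-pres px py)) (majFrom-map n f f-pres (suc i) (py ∷ pys))

pairSum : (ℤ → ℤ → ℕ) → List ℤ → ℕ
pairSum f []       = 0
pairSum f (x ∷ xs) = sum (map (f x) xs) + pairSum f xs

inv+N2≡pairSum : ∀ w → inv w + N2 w ≡ pairSum pairLength w
inv+N2≡pairSum []       = refl
inv+N2≡pairSum (x ∷ xs) =
  trans (interchange (count (λ y → ltᵇ y x) xs) (inv xs) _ (N2 xs))
        (cong₂ _+_ (row xs) (inv+N2≡pairSum xs))
  where
  row : ∀ ys → count (λ y → ltᵇ y x) ys + count (λ y → ltᵇ (x ℤ.+ y) (+ 0)) ys ≡ sum (map (pairLength x) ys)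
  row []       = refl
  row (y ∷ ys) = trans (interchange (toℕ (ltᵇ y x)) _ (toℕ (ltᵇ (x ℤ.+ y) (+ 0))) _)
                       (cong (_+_ (pairLength x y)) (row ys))

pairSum-map : ∀ {P : ℤ → Set} (h : ℤ → ℤ) (f g d : ℤ → ℤ → ℕ) →
              (∀ {x y} → P x → P y → f (h x) (h y) ≡ g x y + d x y) →
              ∀ {w} → All P w → pairSum f (map h w) ≡ pairSum g w + pairSum d w
pairSum-map h f g d split [] = refl
pairSum-map h f g d split {x ∷ xs} (px ∷ pxs) =
  trans (cong₂ _+_ (row pxs) (pairSum-map h f g d split pxs))
        (interchange (sum (map (g x) xs)) _ _ _)
  where
  row : ∀ {ys} → All _ ys → sum (map (f (h x)) (map h ys)) ≡ sum (map (g x) ys) + sum (map (d x) ys)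
  row []         = refl
  row {y ∷ ys} (py ∷ pys) = trans (cong₂ _+_ (split px py) (row pys)) (interchange (g x y) _ _ _)

indicator : ℤ → ℤ → ℕ
indicator t y = toℕ (does (y ℤ.≟ t))

sum-map-≡0 : ∀ {f : ℤ → ℕ} → (∀ y → f y ≡ 0) → ∀ ys → sum (map f ys) ≡ 0
sum-map-≡0 f≗0 []       = refl
sum-map-≡0 f≗0 (y ∷ ys) = cong₂ _+_ (f≗0 y) (sum-map-≡0 f≗0 ys)

sum-indicator-∉ : ∀ {t} ys → t ∉ ys → sum (map (indicator t) ys) ≡ 0
sum-indicator-∉ []       _   = refl
sum-indicator-∉ {t} (y ∷ ys) t∉ with y ℤ.≟ t
... | yes y≡t = ⊥-elim (t∉ (here (sym y≡t)))
... | no  _   = sum-indicator-∉ ys (t∉ ∘ there)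

∈-tail : ∀ {x t : ℤ} {xs} → t ∈ x ∷ xs → x ≢ t → t ∈ xs
∈-tail (here t≡x) x≢t = ⊥-elim (x≢t (sym t≡x))
∈-tail (there t∈) _   = t∈

All≢⇒∉ : ∀ {x : ℤ} {xs} → All (x ≢_) xs → x ∉ xs
All≢⇒∉ all x∈ = All.lookup all x∈ refl

sum-indicator-∈ : ∀ {t ys} → Unique ys → t ∈ ys → sum (map (indicator t) ys) ≡ 1
sum-indicator-∈ {t} {y ∷ ys} (y∉ ∷ unique) t∈ with y ℤ.≟ t
... | yes refl = cong suc (sum-indicator-∉ ys (All≢⇒∉ y∉))
... | no  y≢t  = sum-indicator-∈ unique (∈-tail t∈ y≢t)

module _ (d : ℤ → ℤ → ℕ) {a b : ℤ} (a≢b : a ≢ b)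
         (d-a : ∀ y → d a y ≡ indicator b y) (d-b : ∀ y → d b y ≡ indicator a y)
         (d-other : ∀ {x} y → x ≢ a → x ≢ b → d x y ≡ 0) where

  pairSum-indicator≡0 : ∀ w → a ∉ w ⊎ b ∉ w → pairSum d w ≡ 0
  pairSum-indicator≡0 []       _ = refl
  pairSum-indicator≡0 (x ∷ xs) a∉⊎b∉ with x ℤ.≟ a | x ℤ.≟ b | a∉⊎b∉
  ... | yes refl | _        | inj₁ a∉ = ⊥-elim (a∉ (here refl))
  ... | yes refl | _        | inj₂ b∉ =
    cong₂ _+_ (trans (cong sum (map-cong d-a xs)) (sum-indicator-∉ xs (b∉ ∘ there)))
              (pairSum-indicator≡0 xs (inj₂ (b∉ ∘ there)))
  ... | no _     | yes refl | inj₂ b∉ = ⊥-elim (b∉ (here refl))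
  ... | no _     | yes refl | inj₁ a∉ =
    cong₂ _+_ (trans (cong sum (map-cong d-b xs)) (sum-indicator-∉ xs (a∉ ∘ there)))
              (pairSum-indicator≡0 xs (inj₁ (a∉ ∘ there)))
  ... | no x≢a   | no x≢b   | _       =
    cong₂ _+_ (sum-map-≡0 (λ y → d-other y x≢a x≢b) xs)
              (pairSum-indicator≡0 xs (Data.Sum.map (_∘ there) (_∘ there) a∉⊎b∉))

  pairSum-indicator≡1 : ∀ {w} → Unique w → a ∈ w → b ∈ w → pairSum d w ≡ 1
  pairSum-indicator≡1 {x ∷ xs} (x∉ ∷ unique) a∈ b∈ with x ℤ.≟ a | x ℤ.≟ b
  ... | yes refl | _        =
    cong₂ _+_ (trans (cong sum (map-cong d-a xs)) (sum-indicator-∈ unique (∈-tail b∈ a≢b)))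
              (pairSum-indicator≡0 xs (inj₁ (All≢⇒∉ x∉)))
  ... | no _     | yes refl =
    cong₂ _+_ (trans (cong sum (map-cong d-b xs)) (sum-indicator-∈ unique (∈-tail a∈ (a≢b ∘ sym))))
              (pairSum-indicator≡0 xs (inj₂ (All≢⇒∉ x∉)))
  ... | no x≢a   | no x≢b   =
    cong₂ _+_ (sum-map-≡0 (λ y → d-other y x≢a x≢b) xs) (pairSum-indicator≡1 unique (∈-tail a∈ x≢a) (∈-tail b∈ x≢b))

swapPair-neg : ∀ m y → swapPair m -[1+ m ] y ≡ indicator (+ suc (suc m)) y
swapPair-neg m (+ zero)  = refl
swapPair-neg m (+ suc k) rewrite ≡ᵇ-refl m | ∧-identityʳ (k ≡ᵇ suc m) = refl
swapPair-neg m -[1+ k ]  = refl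

swapPair-pos : ∀ m y → swapPair m (+ suc (suc m)) y ≡ indicator -[1+ m ] y
swapPair-pos m (+ k)     = refl
swapPair-pos m -[1+ k ]  rewrite ≡ᵇ-refl m = refl

swapPair-other : ∀ m {x} y → x ≢ -[1+ m ] → x ≢ + suc (suc m) → swapPair m x y ≡ 0
swapPair-other m {+ zero}  y         _   _   = refl
swapPair-other m {+ suc i} (+ k)     _   _   = refl
swapPair-other m {+ suc i} -[1+ k ]  _   x≢b rewrite ≢⇒≡ᵇ≡false (x≢b ∘ cong (+_ ∘ suc)) = refl
swapPair-other m { -[1+ i ]} -[1+ k ] _  _   = refl
swapPair-other m { -[1+ i ]} (+ zero) _  _   = refl
swapPair-other m { -[1+ i ]} (+ suc k) x≢a _ rewrite ≢⇒≡ᵇ≡false (x≢a ∘ cong -[1+_]) | ∧-zeroʳ (k ≡ᵇ suc m) = refl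

pairSum-swapPair≡1 : ∀ m {w} → Unique w → -[1+ m ] ∈ w → + suc (suc m) ∈ w → pairSum (swapPair m) w ≡ 1
pairSum-swapPair≡1 m = pairSum-indicator≡1 (swapPair m) (λ ()) (swapPair-neg m) (swapPair-pos m) (swapPair-other m)

record IsSignedWindow (n : ℕ) (w : List ℤ) : Set where
  field
    length≡n   : length w ≡ n
    inRange    : All (InRange n) w
    abs-unique : Unique (map ∣_∣ w)

open IsSignedWindow

∣∣-injectiveOn : ∀ {w x y} → Unique (map ∣_∣ w) → x ∈ w → y ∈ w → ∣ x ∣ ≡ ∣ y ∣ → x ≡ y
∣∣-injectiveOn (_ ∷ _)   (here refl) (here refl) _ = refl
∣∣-injectiveOn (u ∷ _)   (here refl) (there y∈)  e = ⊥-elim (All.lookup u (∈-map⁺ ∣_∣ y∈) e)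
∣∣-injectiveOn (u ∷ _)   (there x∈)  (here refl) e = ⊥-elim (All.lookup u (∈-map⁺ ∣_∣ x∈) (sym e))
∣∣-injectiveOn (_ ∷ us)  (there x∈)  (there y∈)  e = ∣∣-injectiveOn us x∈ y∈ e

swapAbs-IsSignedWindow : ∀ {n} m {w} → suc m < n → IsSignedWindow n w → IsSignedWindow n (map (swapAbs m) w)
swapAbs-IsSignedWindow {n} m {w} m′<n sw = record
  { length≡n   = trans (length-map (swapAbs m) w) (length≡n sw)
  ; inRange    = All.map⁺ (All.map (swapAbs-InRange m m′<n) (inRange sw))
  ; abs-unique = subst Unique abs∘swapAbs
                   (Unique.map⁺ (λ {i} {j} e → trans (sym (swap-involutive (suc m) i))
                                                (trans (cong (swap (suc m)) e) (swap-involutive (suc m) j)))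
                                (abs-unique sw))
  }
  where
  abs∘swapAbs : map (swap (suc m)) (map ∣_∣ w) ≡ map ∣_∣ (map (swapAbs m) w)
  abs∘swapAbs = trans (sym (map-∘ w)) (trans (map-cong (sym ∘ ∣swapAbs∣ m) w) (map-∘ w))

Compatible-∈ : ∀ {n m w x} → IsSignedWindow n w → -[1+ m ] ∈ w → + suc (suc m) ∈ w → x ∈ w → Compatible m x
Compatible-∈ {x = + zero}   sw _  _  x∈ = All.lookup (inRange sw) x∈
Compatible-∈ {x = + suc i}  sw a∈ _  x∈ refl with ∣∣-injectiveOn (abs-unique sw) x∈ a∈ refl
... | ()
Compatible-∈ {x = -[1+ i ]} sw _  b∈ x∈ refl with ∣∣-injectiveOn (abs-unique sw) x∈ b∈ refl
... | ()

ℓB≡pairSum+N1 : ∀ w → ℓB w ≡ pairSum pairLength w + N1 w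
ℓB≡pairSum+N1 w = trans (xy∙z≈xz∙y (inv w) (N1 w) (N2 w)) (cong (_+ N1 w) (inv+N2≡pairSum w))

module _ {n m w} (sw : IsSignedWindow n w) (a∈ : -[1+ m ] ∈ w) (b∈ : + suc (suc m) ∈ w) where

  private
    compatible : All (Compatible m) w
    compatible = All.tabulate (Compatible-∈ sw a∈ b∈)

    pairSum-swapAbs : pairSum pairLength (map (swapAbs m) w) ≡ pairSum pairLength w + 1
    pairSum-swapAbs = trans (pairSum-map (swapAbs m) pairLength pairLength (swapPair m) (pairLength-swapAbs m _ _) compatible)
                            (cong (_+_ (pairSum pairLength w)) (pairSum-swapPair≡1 m (Unique.map⁻ (abs-unique sw)) a∈ b∈))

  ℓB-swapAbs : ℓB (map (swapAbs m) w) ≡ suc (ℓB w)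
  ℓB-swapAbs = begin
    ℓB (map (swapAbs m) w)                                          ≡⟨ ℓB≡pairSum+N1 (map (swapAbs m) w) ⟩
    pairSum pairLength (map (swapAbs m) w) + N1 (map (swapAbs m) w) ≡⟨ cong₂ _+_ pairSum-swapAbs (N1-swapAbs m w) ⟩
    (pairSum pairLength w + 1) + N1 w                                ≡⟨ cong (_+ N1 w) (ℕ.+-comm (pairSum pairLength w) 1) ⟩
    suc (pairSum pairLength w + N1 w)                                ≡⟨ cong suc (ℓB≡pairSum+N1 w) ⟨
    suc (ℓB w)                                                       ∎
    where open ≡-Reasoning

  fmaj-swapAbs : fmaj n (map (swapAbs m) w) ≡ fmaj n w
  fmaj-swapAbs = cong₂ (λ a b → 2 * a + b) maj-swapAbs (N1-swapAbs m w)
    where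
    m′<n : suc m < n
    m′<n = All.lookup (inRange sw) b∈
    maj-swapAbs : maj n (map (swapAbs m) w) ≡ maj n w
    maj-swapAbs = majFrom-map n (swapAbs m)
      (λ (x-in , x-comp) (y-in , y-comp) → succᵇ-swapAbs m _ _ m′<n x-in y-in x-comp y-comp)
      1 (All.zip (inRange sw , compatible))

IsSignedWindow-full : ∀ {n w} → IsSignedWindow n w → ∀ {i} → i < n → -[1+ i ] ∈ w ⊎ + suc i ∈ w
IsSignedWindow-full {n} {w} sw {i} i<n with suc i ∈ℕ? map ∣_∣ w
... | yes p with ∈-map⁻ ∣_∣ p
...   | + suc _  , x∈ , refl = inj₂ x∈
...   | -[1+ _ ] , x∈ , refl = inj₁ x∈
IsSignedWindow-full {n} {w} sw {i} i<n | no suc-i∉ =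
  ⊥-elim (ℕ.<-irrefl refl (subst₂ _<_ (trans (length-map ∣_∣ w) (length≡n sw)) (trans (length-map suc (upTo n)) (length-upTo n))
    (Unique-⊂⇒length< (abs-unique sw) abs∈ (∈-map⁺ suc (∈-upTo⁺ i<n)) suc-i∉)))
  where
  abs∈ : ∀ {a} → a ∈ map ∣_∣ w → a ∈ map suc (upTo n)
  abs∈ p with ∈-map⁻ ∣_∣ p
  ... | x , x∈ , refl with x | All.lookup (inRange sw) x∈
  ...   | + suc j  | j<n = ∈-map⁺ suc (∈-upTo⁺ j<n)
  ...   | -[1+ j ] | j<n = ∈-map⁺ suc (∈-upTo⁺ j<n)

∈values⇒InRange : ∀ {n x} → x ∈ values n → InRange n x
∈values⇒InRange {n} p with ∈-++⁻ (map -[1+_] (upTo n)) p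
... | inj₁ p₁ with ∈-map⁻ -[1+_] p₁
...   | _ , i∈ , refl = ∈-upTo⁻ i∈
∈values⇒InRange {n} p | inj₂ p₂ with ∈-map⁻ (+_ ∘ suc) p₂
...   | _ , i∈ , refl = ∈-upTo⁻ i∈

InRange⇒∈values : ∀ {n} x → InRange n x → x ∈ values n
InRange⇒∈values {n} (+ suc i) i<n = ∈-++⁺ʳ (map -[1+_] (upTo n)) (∈-map⁺ (+_ ∘ suc) (∈-upTo⁺ i<n))
InRange⇒∈values {n} -[1+ i ]  i<n = ∈-++⁺ˡ (∈-map⁺ -[1+_] (∈-upTo⁺ i<n))

∈words⇒ : ∀ n k {w} → w ∈ words n k → length w ≡ k × All (InRange n) w
∈words⇒ n zero    (here refl) = refl , []
∈words⇒ n (suc k) p with find (∈-concatMap⁻ (λ x → map (x ∷_) (words n k)) {xs = values n} p)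
... | x , x∈ , p′ with ∈-map⁻ (x ∷_) p′
...   | w , w∈ , refl with ∈words⇒ n k w∈
...     | len , inRange = cong suc len , ∈values⇒InRange x∈ ∷ inRange

⇒∈words : ∀ n k {w} → length w ≡ k → All (InRange n) w → w ∈ words n k
⇒∈words n zero    {[]}    refl []             = here refl
⇒∈words n (suc k) {x ∷ w} len  (x-in ∷ inRange) =
  ∈-concatMap⁺ (λ x → map (x ∷_) (words n k))
    (Any.map (λ { refl → ∈-map⁺ (x ∷_) (⇒∈words n k (ℕ.suc-injective len) inRange) }) (InRange⇒∈values x x-in))

values-unique : ∀ n → Unique (values n)
values-unique n =
  Unique.++⁺ (Unique.map⁺ (λ { refl → refl }) (Unique.upTo⁺ n)) (Unique.map⁺ (λ { refl → refl }) (Unique.upTo⁺ n)) disjoint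
  where
  disjoint : ∀ {v} → ¬ (v ∈ map -[1+_] (upTo n) × v ∈ map (+_ ∘ suc) (upTo n))
  disjoint (p , q) with ∈-map⁻ -[1+_] p | ∈-map⁻ (+_ ∘ suc) q
  ... | _ , _ , refl | _ , _ , ()

concatMap-cons-unique : ∀ (xs : List ℤ) (ws : List (List ℤ)) → Unique xs → Unique ws →
                        Unique (concatMap (λ x → map (x ∷_) ws) xs)
concatMap-cons-unique []       ws _        _   = []
concatMap-cons-unique (x ∷ xs) ws (x∉ ∷ u) uws =
  Unique.++⁺ (Unique.map⁺ ∷-injectiveʳ uws) (concatMap-cons-unique xs ws u uws) disjoint
  where
  disjoint : ∀ {v} → ¬ (v ∈ map (x ∷_) ws × v ∈ concatMap (λ y → map (y ∷_) ws) xs)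
  disjoint (p , q) with ∈-map⁻ (x ∷_) p | find (∈-concatMap⁻ (λ y → map (y ∷_) ws) {xs = xs} q)
  ... | _ , _ , refl | y , y∈ , q′ with ∈-map⁻ (y ∷_) q′
  ...   | _ , _ , refl = All.lookup x∉ y∈ refl

words-unique : ∀ n k → Unique (words n k)
words-unique n zero    = [] ∷ []
words-unique n (suc k) = concatMap-cons-unique (values n) (words n k) (values-unique n) (words-unique n k)

InDelta1 : ℕ → List ℤ → Set
InDelta1 n w = IsSignedWindow n w × (lastPos w ∧ oddᵇ (fmaj n w)) ≡ true

∈Delta1⇒ : ∀ n {w} → w ∈ Delta1 n → InDelta1 n w
∈Delta1⇒ n p with ∈-filter⁻ (λ w → (lastPos w ∧ oddᵇ (fmaj n w)) Data.Bool.≟ true) {xs = Bn n} p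
... | p′ , cond with ∈-filter⁻ (λ w → isSignedPerm w Data.Bool.≟ true) {xs = words n n} p′
...   | p″ , signed with ∈words⇒ n n p″
...     | len , inRange = record { length≡n = len ; inRange = inRange ; abs-unique = isYes≡true⇒ _ signed } , cond

⇒∈Delta1 : ∀ n {w} → InDelta1 n w → w ∈ Delta1 n
⇒∈Delta1 n (sw , cond) =
  ∈-filter⁺ (λ w → (lastPos w ∧ oddᵇ (fmaj n w)) Data.Bool.≟ true)
    (∈-filter⁺ (λ w → isSignedPerm w Data.Bool.≟ true) (⇒∈words n n (length≡n sw) (inRange sw))
       (⇒isYes≡true _ (abs-unique sw)))
    cond

Delta1-unique : ∀ n → Unique (Delta1 n)
Delta1-unique n = Unique.filter⁺ _ (Unique.filter⁺ _ (words-unique n n))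

-- The toggle involution
infix 7 _∈ᵇ_

_∈ᵇ_ : ℤ → List ℤ → Bool
t ∈ᵇ w = does (t ∈? w)

∈⇒∈ᵇ : ∀ {t w} → t ∈ w → (t ∈ᵇ w) ≡ true
∈⇒∈ᵇ {t} {w} t∈ with t ∈? w
... | yes _  = refl
... | no t∉  = ⊥-elim (t∉ t∈)

∈ᵇ⇒∈ : ∀ {t w} → (t ∈ᵇ w) ≡ true → t ∈ w
∈ᵇ⇒∈ {t} {w} e with t ∈? w
... | yes t∈ = t∈

∈ᵇ-swapAbs : ∀ m t w → (t ∈ᵇ map (swapAbs m) w) ≡ (swapAbs m t ∈ᵇ w)
∈ᵇ-swapAbs m t w = does-⇔ (mk⇔ to from) (t ∈? map (swapAbs m) w) (swapAbs m t ∈? w)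
  where
  to : t ∈ map (swapAbs m) w → swapAbs m t ∈ w
  to p with ∈-map⁻ (swapAbs m) p
  ... | y , y∈ , refl = subst (_∈ w) (sym (swapAbs-involutive m y)) y∈
  from : swapAbs m t ∈ w → t ∈ map (swapAbs m) w
  from p = subst (_∈ map (swapAbs m) w) (swapAbs-involutive m t) (∈-map⁺ (swapAbs m) p)

oppositeAt : ℕ → List ℤ → Bool
oppositeAt m w = (-[1+ m ] ∈ᵇ w ∧ + suc (suc m) ∈ᵇ w) ∨ (+ suc m ∈ᵇ w ∧ -[1+ suc m ] ∈ᵇ w)

oppositeAt-swapAbs-same : ∀ m w → oppositeAt m (map (swapAbs m) w) ≡ oppositeAt m w
oppositeAt-swapAbs-same m w
  rewrite ∈ᵇ-swapAbs m -[1+ m ] w | ∈ᵇ-swapAbs m (+ suc (suc m)) w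
        | ∈ᵇ-swapAbs m (+ suc m) w | ∈ᵇ-swapAbs m -[1+ suc m ] w
        | swap-left m | swap-right m
  = ∧∨∧-comm (-[1+ suc m ] ∈ᵇ w) (+ suc m ∈ᵇ w) (+ suc (suc m) ∈ᵇ w) (-[1+ m ] ∈ᵇ w)

oppositeAt-swapAbs-other : ∀ m {m′} w → m′ ≢ m → m′ ≢ suc m → suc m′ ≢ m → suc m′ ≢ suc m →
                           oppositeAt m′ (map (swapAbs m) w) ≡ oppositeAt m′ w
oppositeAt-swapAbs-other m {m′} w p q r s
  rewrite ∈ᵇ-swapAbs m -[1+ m′ ] w | ∈ᵇ-swapAbs m (+ suc (suc m′)) w
        | ∈ᵇ-swapAbs m (+ suc m′) w | ∈ᵇ-swapAbs m -[1+ suc m′ ] w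
        | swap-fixes m p q | swap-fixes m r s
  = refl

opposite : List ℤ → ℕ → Bool
opposite w j = oppositeAt (2 * j) w

opposite-swapAbs : ∀ j w i → opposite (map (swapAbs (2 * j)) w) i ≡ opposite w i
opposite-swapAbs j w i with i ℕ.≟ j
... | yes refl = oppositeAt-swapAbs-same (2 * i) w
... | no  i≢j  = oppositeAt-swapAbs-other (2 * j) w
  (i≢j ∘ ℕ.*-cancelˡ-≡ i j 2) (ℕ.even≢odd i j) (ℕ.even≢odd j i ∘ sym) (i≢j ∘ ℕ.*-cancelˡ-≡ i j 2 ∘ ℕ.suc-injective)

swapAt : Maybe ℕ → List ℤ → List ℤ
swapAt (just j) w = map (swapAbs (2 * j)) w
swapAt nothing  w = w

firstOpposite : List ℤ → Maybe ℕ
firstOpposite w = search (opposite w) 0 (length w)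

toggle : List ℤ → List ℤ
toggle w = swapAt (firstOpposite w) w

firstOpposite-swapAbs : ∀ j w → firstOpposite (map (swapAbs (2 * j)) w) ≡ firstOpposite w
firstOpposite-swapAbs j w rewrite length-map (swapAbs (2 * j)) w = search-cong (opposite-swapAbs j w) 0 (length w)

toggle-involutive : ∀ w → toggle (toggle w) ≡ w
toggle-involutive w with firstOpposite w in e
... | nothing rewrite e = refl
... | just j  rewrite firstOpposite-swapAbs j w | e = map-swapAbs-involutive (2 * j) w

oppositeAt-intro₁ : ∀ {m w} → -[1+ m ] ∈ w → + suc (suc m) ∈ w → oppositeAt m w ≡ true
oppositeAt-intro₁ a∈ b∈ rewrite ∈⇒∈ᵇ a∈ | ∈⇒∈ᵇ b∈ = refl

oppositeAt-intro₂ : ∀ {m w} → + suc m ∈ w → -[1+ suc m ] ∈ w → oppositeAt m w ≡ true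
oppositeAt-intro₂ {m} {w} c∈ d∈ rewrite ∈⇒∈ᵇ c∈ | ∈⇒∈ᵇ d∈ = ∨-zeroʳ (-[1+ m ] ∈ᵇ w ∧ + suc (suc m) ∈ᵇ w)

oppositeAt-elim : ∀ m w → oppositeAt m w ≡ true →
                  (-[1+ m ] ∈ w × + suc (suc m) ∈ w) ⊎ (+ suc m ∈ w × -[1+ suc m ] ∈ w)
oppositeAt-elim m w e =
  Data.Sum.map (λ (a , b) → ∈ᵇ⇒∈ a , ∈ᵇ⇒∈ b) (λ (c , d) → ∈ᵇ⇒∈ c , ∈ᵇ⇒∈ d)
    (∧∨∧≡true (-[1+ m ] ∈ᵇ w) (+ suc (suc m) ∈ᵇ w) (+ suc m ∈ᵇ w) (-[1+ suc m ] ∈ᵇ w) e)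

-- Windows whose paired absolute values agree in sign
isEven : ℕ → Bool
isEven zero          = true
isEven (suc zero)    = false
isEven (suc (suc i)) = isEven i

mate : ℕ → ℕ
mate zero          = 1
mate (suc zero)    = 0
mate (suc (suc i)) = suc (suc (mate i))

mate-involutive : ∀ i → mate (mate i) ≡ i
mate-involutive zero          = refl
mate-involutive (suc zero)    = refl
mate-involutive (suc (suc i)) = cong (suc ∘ suc) (mate-involutive i)

isEven-mate : ∀ i → isEven (mate i) ≡ not (isEven i)
isEven-mate zero          = refl
isEven-mate (suc zero)    = refl
isEven-mate (suc (suc i)) = isEven-mate i

double-suc : ∀ j → suc (suc (2 * j)) ≡ 2 * suc j
double-suc j = sym (ℕ.*-suc 2 j)

mate-pair : ∀ i → ∃ λ j → (i ≡ 2 * j × mate i ≡ suc (2 * j)) ⊎ (i ≡ suc (2 * j) × mate i ≡ 2 * j)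
mate-pair zero          = 0 , inj₁ (refl , refl)
mate-pair (suc zero)    = 0 , inj₂ (refl , refl)
mate-pair (suc (suc i)) with mate-pair i
... | j , inj₁ (i≡ , mate≡) =
  suc j , inj₁ (trans (cong (suc ∘ suc) i≡) (double-suc j) , trans (cong (suc ∘ suc) mate≡) (cong suc (double-suc j)))
... | j , inj₂ (i≡ , mate≡) =
  suc j , inj₂ (trans (cong (suc ∘ suc) i≡) (cong suc (double-suc j)) , trans (cong (suc ∘ suc) mate≡) (double-suc j))

mate-< : ∀ {k i} → i < 2 * k → mate i < 2 * k
mate-< {k} {i} i<2k with mate-pair i
... | j , inj₁ (refl , mate≡) = subst (_< 2 * k) (sym mate≡) (ℕ.≤∧≢⇒< i<2k (ℕ.even≢odd k j ∘ sym))
... | j , inj₂ (refl , mate≡) = subst (_< 2 * k) (sym mate≡) (ℕ.<-trans (ℕ.n<1+n (2 * j)) i<2k)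

negEven negOdd : ℤ → Bool
negEven (+ _)      = false
negEven -[1+ i ]   = isEven i
negOdd  (+ _)      = false
negOdd  -[1+ i ]   = not (isEven i)

N1≡negEven+negOdd : ∀ w → N1 w ≡ count negEven w + count negOdd w
N1≡negEven+negOdd []            = refl
N1≡negEven+negOdd (+ j ∷ w)     rewrite ltᵇ-+-+ j 0 = N1≡negEven+negOdd w
N1≡negEven+negOdd (-[1+ i ] ∷ w) with isEven i
... | true  = cong suc (N1≡negEven+negOdd w)
... | false = trans (cong suc (N1≡negEven+negOdd w)) (sym (ℕ.+-suc _ _))

negParity : ℤ → ℤ
negParity (+ _)    = + 0
negParity -[1+ i ] = if isEven i then + 1 else -[1+ 0 ]

sum-negParity : ∀ w → sumℤ (map negParity w) ≡ + count negEven w ℤ.- + count negOdd w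
sum-negParity []             = refl
sum-negParity (+ j ∷ w)      = trans (ℤ.+-identityˡ _) (sum-negParity w)
sum-negParity (-[1+ i ] ∷ w) with isEven i
... | true  = trans (cong (ℤ._+_ (+ 1)) (sum-negParity w)) (sym (ℤ.+-assoc (+ 1) (+ count negEven w) (- (+ count negOdd w))))
... | false = trans (cong (ℤ._+_ -[1+ 0 ]) (sum-negParity w)) (shift (+ count negEven w) (+ count negOdd w))
  where
  shift : ∀ s o → -[1+ 0 ] ℤ.+ (s ℤ.- o) ≡ s ℤ.- (+ 1 ℤ.+ o)
  shift = solve-∀

mateNeg : ℤ → ℤ
mateNeg (+ j)     = + j
mateNeg -[1+ i ]  = -[1+ mate i ]

mateNeg-involutive : ∀ x → mateNeg (mateNeg x) ≡ x
mateNeg-involutive (+ j)    = refl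
mateNeg-involutive -[1+ i ] = cong -[1+_] (mate-involutive i)

negParity-mateNeg : ∀ x → negParity (mateNeg x) ≡ - negParity x
negParity-mateNeg (+ j)    = refl
negParity-mateNeg -[1+ i ] rewrite isEven-mate i with isEven i
... | true  = refl
... | false = refl

oddᵇ-double : ∀ a → oddᵇ (2 * a) ≡ false
oddᵇ-double a = cong (_≡ᵇ 1) (trans (cong (_% 2) (ℕ.*-comm 2 a)) (m*n%n≡0 a 2))

module _ {n k w} (n≡2k : n ≡ 2 * k) (sw : IsSignedWindow n w)
         (no-opposite : ∀ {j} → j < n → opposite w j ≡ false) where

  private
    opposite-absurd : ∀ {j} → 2 * j < n → opposite w j ≢ true
    opposite-absurd {j} 2j<n e with trans (sym e) (no-opposite (ℕ.≤-<-trans (ℕ.m≤n*m j 2) 2j<n))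
    ... | ()

    -- The absolute value of the mate occurs in w, and with positive sign it would form an opposite pair.
    mateNeg-closed : ∀ {x} → x ∈ w → mateNeg x ∈ w
    mateNeg-closed {+ j}      x∈ = x∈
    mateNeg-closed { -[1+ i ]} x∈
      with IsSignedWindow-full sw (subst (mate i <_) (sym n≡2k) (mate-< {k} (subst (i <_) n≡2k (All.lookup (inRange sw) x∈))))
    ... | inj₁ neg∈ = neg∈
    ... | inj₂ pos∈ with mate-pair i
    ...   | j , inj₁ (refl , mate≡) =
      ⊥-elim (opposite-absurd {j} (All.lookup (inRange sw) x∈)
               (oppositeAt-intro₁ x∈ (subst (λ t → + suc t ∈ w) mate≡ pos∈)))
    ...   | j , inj₂ (refl , mate≡) =
      ⊥-elim (opposite-absurd {j} (ℕ.<-trans (ℕ.n<1+n (2 * j)) (All.lookup (inRange sw) x∈))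
               (oppositeAt-intro₂ (subst (λ t → + suc t ∈ w) mate≡ pos∈) x∈))

    count-negEven≡negOdd : count negEven w ≡ count negOdd w
    count-negEven≡negOdd = ℤ.+-injective (ℤ.i-j≡0⇒i≡j _ _ (trans (sym (sum-negParity w))
      (sumℤ-signReversing≡0 mateNeg-involutive (Unique.map⁻ (abs-unique sw)) mateNeg-closed
                            negParity (λ {x} _ → negParity-mateNeg x))))

  N1-even : N1 w ≡ 2 * count negEven w
  N1-even = begin
    N1 w                                ≡⟨ N1≡negEven+negOdd w ⟩
    count negEven w + count negOdd w    ≡⟨ cong (_+_ (count negEven w)) (sym count-negEven≡negOdd) ⟩
    count negEven w + count negEven w   ≡⟨ cong (_+_ (count negEven w)) (ℕ.+-identityʳ _) ⟨
    2 * count negEven w                 ∎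
    where open ≡-Reasoning

  fmaj-even : oddᵇ (fmaj n w) ≡ false
  fmaj-even = begin
    oddᵇ (2 * maj n w + N1 w)                  ≡⟨ cong (λ t → oddᵇ (2 * maj n w + t)) N1-even ⟩
    oddᵇ (2 * maj n w + 2 * count negEven w)   ≡⟨ cong oddᵇ (ℕ.*-distribˡ-+ 2 (maj n w) (count negEven w)) ⟨
    oddᵇ (2 * (maj n w + count negEven w))     ≡⟨ oddᵇ-double (maj n w + count negEven w) ⟩
    false                                      ∎
    where open ≡-Reasoning

-- Cancellation
signℤ-suc-suc : ∀ m → signℤ (suc (suc m)) ≡ signℤ m
signℤ-suc-suc m = cong (λ r → if r ≡ᵇ 0 then + 1 else - (+ 1)) (trans (cong (_% 2) (ℕ.+-comm 2 m)) ([m+n]%n≡m%n m 2))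

signℤ-suc : ∀ m → signℤ (suc m) ≡ - signℤ m
signℤ-suc zero    = refl
signℤ-suc (suc m) = trans (signℤ-suc-suc m) (trans (sym (ℤ.neg-involutive (signℤ m))) (cong -_ (sym (signℤ-suc m))))

record SignFlip (n : ℕ) (w w′ : List ℤ) : Set where
  field
    window   : IsSignedWindow n w′
    lastPos≡ : lastPos w′ ≡ lastPos w
    fmaj≡    : fmaj n w′ ≡ fmaj n w
    sign≡    : signℤ (ℓB w′) ≡ - signℤ (ℓB w)

swapAbs-SignFlip : ∀ {n m w} → IsSignedWindow n w → oppositeAt m w ≡ true → SignFlip n w (map (swapAbs m) w)
swapAbs-SignFlip {n} {m} {w} sw opp with oppositeAt-elim m w opp
... | inj₁ (a∈ , b∈) = record
  { window   = swapAbs-IsSignedWindow m (All.lookup (inRange sw) b∈) sw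
  ; lastPos≡ = lastPos-swapAbs m w
  ; fmaj≡    = fmaj-swapAbs sw a∈ b∈
  ; sign≡    = trans (cong signℤ (ℓB-swapAbs sw a∈ b∈)) (signℤ-suc (ℓB w))
  }
... | inj₂ (c∈ , d∈) = record
  { window   = sw′
  ; lastPos≡ = lastPos-swapAbs m w
  ; fmaj≡    = sym (trans (cong (fmaj n) (sym (map-swapAbs-involutive m w))) (fmaj-swapAbs sw′ a∈′ b∈′))
  ; sign≡    = begin
      signℤ (ℓB w′)           ≡⟨ ℤ.neg-involutive (signℤ (ℓB w′)) ⟨
      - - signℤ (ℓB w′)       ≡⟨ cong -_ (signℤ-suc (ℓB w′)) ⟨
      - signℤ (suc (ℓB w′))   ≡⟨ cong (-_ ∘ signℤ) ℓB≡ ⟨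
      - signℤ (ℓB w)          ∎
  }
  where
  w′ : List ℤ
  w′ = map (swapAbs m) w
  sw′ : IsSignedWindow n w′
  sw′ = swapAbs-IsSignedWindow m (All.lookup (inRange sw) d∈) sw
  a∈′ : -[1+ m ] ∈ w′
  a∈′ = subst (λ t → -[1+ t ] ∈ w′) (swap-right m) (∈-map⁺ (swapAbs m) d∈)
  b∈′ : + suc (suc m) ∈ w′
  b∈′ = subst (λ t → + suc t ∈ w′) (swap-left m) (∈-map⁺ (swapAbs m) c∈)
  ℓB≡ : ℓB w ≡ suc (ℓB w′)
  ℓB≡ = trans (cong ℓB (sym (map-swapAbs-involutive m w))) (ℓB-swapAbs sw′ a∈′ b∈′)
  open ≡-Reasoning

toggle-SignFlip : ∀ {n k w} → n ≡ 2 * k → InDelta1 n w → SignFlip n w (toggle w)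
toggle-SignFlip {n} {k} {w} n≡2k (sw , cond) with firstOpposite w in e
... | just j  = swapAbs-SignFlip sw (search-sound (opposite w) 0 (length w) e)
... | nothing with trans (sym (proj₂ (∧≡true (lastPos w) _ cond))) (fmaj-even {k = k} n≡2k sw no-opposite)
  where
  no-opposite : ∀ {j} → j < n → opposite w j ≡ false
  no-opposite j<n = search-complete (opposite w) 0 (length w) e z≤n (subst (_ <_) (sym (length≡n sw)) j<n)
...   | ()

SignFlip-InDelta1 : ∀ {n w w′} → InDelta1 n w → SignFlip n w w′ → InDelta1 n w′
SignFlip-InDelta1 (_ , cond) t = window , trans (cong₂ (λ p f → p ∧ oddᵇ f) lastPos≡ fmaj≡) cond
  where open SignFlip t

coeffTerm : ℕ → ℕ → List ℤ → ℤ
coeffTerm n k w = if fmaj n w ≡ᵇ k then signℤ (ℓB w) else + 0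

coeffTerm-SignFlip : ∀ {n w w′} k → SignFlip n w w′ → coeffTerm n k w′ ≡ - coeffTerm n k w
coeffTerm-SignFlip {n} {w} k t =
  trans (cong₂ (λ f s → if f ≡ᵇ k then s else + 0) fmaj≡ sign≡) (if-then-neg (fmaj n w ≡ᵇ k) (signℤ (ℓB w)))
  where open SignFlip t

even⇒≡2*half : ∀ {n} → n % 2 ≡ 0 → n ≡ 2 * (n / 2)
even⇒≡2*half {n} n%2≡0 = trans (m≡m%n+[m/n]*n n 2) (trans (cong (_+ (n / 2) * 2) n%2≡0) (ℕ.*-comm (n / 2) 2))

lemma4p7 : (n : ℕ) → 0 < n → n % 2 ≡ 0 → (k : ℕ) → coeffDelta1 n k ≡ + 0
lemma4p7 n _ n%2≡0 k =
  sumℤ-signReversing≡0 toggle-involutive (Delta1-unique n) toggle-∈ (coeffTerm n k)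
    (coeffTerm-SignFlip k ∘ flips)
  where
  flips : ∀ {w} → w ∈ Delta1 n → SignFlip n w (toggle w)
  flips w∈ = toggle-SignFlip {k = n / 2} (even⇒≡2*half n%2≡0) (∈Delta1⇒ n w∈)
  toggle-∈ : ∀ {w} → w ∈ Delta1 n → toggle w ∈ Delta1 n
  toggle-∈ w∈ = ⇒∈Delta1 n (SignFlip-InDelta1 (∈Delta1⇒ n w∈) (flips w∈))
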